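{- Let $B \geq 2$ be an integer and $j \in \{1, \ldots, B-1\}$. For $n \geq 0$ let $N_{j,B}(n)$ be the number of occurrences of the digit $j$ in the $B$-ary expansion of $n$. Then $$\sum_{n \geq 1} (-1)^{N_{j,B}(n)} \left(\frac{2}{Bn+j} + \frac{1}{Bn} \sum_{1 \leq k \leq B - 1} \frac{k}{Bn+k}\right) = H_{B-1} - \frac{2}{j}$$ and $$\sum_{n \geq 1} (-1)^{N_{j,B}(n)} \left(\frac{B-1}{n(n+1)} + \frac{2B}{(Bn+j)(Bn+j+1)}\right) = B - 1 - \frac{2B}{j(j+1)}.$$
   Context: $H_m := \sum_{1 \leq k \leq m} \frac{1}{k}$ denotes the $m$th harmonic number. -}

module Defs where

open import Data.Nat as ℕ using (ℕ; zero; suc; _≤_; _≤?_)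
open import Data.Nat.Properties using (_≟_)
open import Data.Integer using (+_)
open import Data.Fin using (toℕ)
open import Data.List using (List; length; filter)
open import Data.Product using (proj₁)
open import Data.Digit using (toDigits)
open import Data.Rational using (ℚ; 0ℚ; 1ℚ; _+_; _-_; _<_; ∣_∣; -_) renaming (_/_ to _÷_)
open import Data.Product using (∃-syntax)
open import Relation.Nullary.Decidable using (fromWitness)

digitCount : (B : ℕ) → 2 ≤ B → (j n : ℕ) → ℕ
digitCount B 2≤B j n =
  length (filter (λ d → toℕ d ≟ j) (proj₁ (toDigits B {fromWitness 2≤B} n)))

signPow : ℕ → ℚ
signPow zero = 1ℚ
signPow (suc k) = - signPow k

-- 1/m as a rational (only ever applied to m ≥ 1; convention 1/0 = 0 is never used)
inv : ℕ → ℚ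
inv zero = 0ℚ
inv (suc m) = + 1 ÷ suc m

sum1 : (ℕ → ℚ) → ℕ → ℚ
sum1 f zero = 0ℚ
sum1 f (suc m) = sum1 f m + f (suc m)

H : ℕ → ℚ
H m = sum1 inv m

SeriesSumsTo : (ℕ → ℚ) → ℚ → Set
SeriesSumsTo a L = ∀ (ε : ℚ) → 0ℚ < ε → ∃[ N ] (∀ M → N ≤ M → ∣ sum1 a M - L ∣ < ε)

-- Write s n = (-1)^N(n) for N = N_{j,B}. The base-B digits of B n + k are those of n preceded by k,
-- so s (B n + k) = σ k · s n with σ j = -1 and σ k = 1 otherwise. Grouping the terms of the signed
-- sum S_g M = Σ_{m ≤ M} s m · g m in blocks of B therefore gives
--   Σ_{n ≤ N} s n · (g n - Σ_{k < B} σ k · g (B n + k)) = S_g (B - 1) - (S_g (B N + B - 1) - S_g N).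
-- The first series is of this form for g n = 1/n, the second is B times it for g n = 1/(n(n+1)),
-- and the limits are S_g (B - 1), resp. B · S_g (B - 1); it remains to show that the gap
-- S_g (B N + B - 1) - S_g N tends to 0.
-- For g n = 1/(n(n+1)) it is a tail of an absolutely convergent series. For g n = 1/n the block sum
-- is ρ/n + O(1/n²) with ρ = (B - 2)/B, so the gap E satisfies |E (B N + r)| ≤ ρ |E N| + 2/N, and
-- iterating this contraction drives E to 0.

module Submission where

open import Data.Bool using (if_then_else_; true; false)
open import Data.Digit using (Expansion; toDigits; fromDigits)
open import Data.Fin using (Fin; toℕ; fromℕ<)
import Data.Fin.Properties as Fin
open import Data.Integer using (+_)
import Data.Integer as ℤ
import Data.Integer.Properties as ℤ
open import Data.List using ([]; _∷_; length; filter)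
open import Data.Nat using (ℕ; zero; suc; z≤n; s≤s; _≤_; _<_)
import Data.Nat as ℕ
open import Data.Nat.DivMod using (_%_; [m+kn]%n≡m%n; m<n⇒m%n≡m; m≡m%n+[m/n]*n; m%n<n; m*n/n≡m; /-monoˡ-≤)
import Data.Nat.Properties as ℕ
open import Data.Nat.Tactic.RingSolver using (solve-∀)
open import Data.Product using (_×_; _,_; ∃-syntax; proj₁; proj₂)
open import Data.Rational using (ℚ; mkℚ; 0ℚ; 1ℚ; ½; _+_; _-_; _*_; -_; ∣_∣; toℚᵘ) renaming (_/_ to _÷_)
import Data.Rational as ℚ
import Data.Rational.Properties as ℚ
open import Data.Rational.Solver using (module +-*-Solver)
open import Data.Rational.Unnormalised using (mkℚᵘ; *≡*)
import Data.Rational.Unnormalised as ℚᵘ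
import Data.Rational.Unnormalised.Properties as ℚᵘ
open import Data.Sum using (inj₁; inj₂)
open import Relation.Binary.PropositionalEquality
open import Relation.Nullary using (does)
open import Relation.Nullary.Decidable using (dec-true; dec-false; fromWitness)

open import Defs

open +-*-Solver using (solve; con; _:+_; _:*_; _:-_; :-_; _:=_)

p≤p+q : ∀ {p q} → 0ℚ ℚ.≤ q → p ℚ.≤ p + q
p≤p+q {p} {q} 0≤q = subst (ℚ._≤ p + q) (ℚ.+-identityʳ p) (ℚ.+-monoʳ-≤ p 0≤q)

p-q≤p : ∀ {p q} → 0ℚ ℚ.≤ q → p - q ℚ.≤ p
p-q≤p {p} {q} 0≤q = subst (p - q ℚ.≤_) (ℚ.+-identityʳ p) (ℚ.+-monoʳ-≤ p (ℚ.neg-antimono-≤ 0≤q))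

∣p-q∣≡q-p : ∀ {p q} → p ℚ.≤ q → ∣ p - q ∣ ≡ q - p
∣p-q∣≡q-p {p} {q} p≤q = begin
  ∣ p - q ∣       ≡⟨ cong ∣_∣ (solve 2 (λ p q → p :- q := :- (q :- p)) refl p q) ⟩
  ∣ - (q - p) ∣   ≡⟨ ℚ.∣-p∣≡∣p∣ (q - p) ⟩
  ∣ q - p ∣       ≡⟨ ℚ.0≤p⇒∣p∣≡p q-p≥0 ⟩
  q - p           ∎
  where
  open ≡-Reasoning
  q-p≥0 : 0ℚ ℚ.≤ q - p
  q-p≥0 = subst (ℚ._≤ q - p) (ℚ.+-inverseʳ p) (ℚ.+-monoˡ-≤ (- p) p≤q)

-- _÷_ normalises by a gcd, so identities for fromℕ and inv are checked in ℚᵘ, where they are ring identities on ℤ.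
fromℕ : ℕ → ℚ
fromℕ n = + n ÷ 1

toℚᵘ-fromℕ : ∀ n → toℚᵘ (fromℕ n) ℚᵘ.≃ mkℚᵘ (+ n) 0
toℚᵘ-fromℕ n = ℚ.toℚᵘ-fromℚᵘ (mkℚᵘ (+ n) 0)

toℚᵘ-inv : ∀ m → toℚᵘ (inv (suc m)) ℚᵘ.≃ mkℚᵘ (+ 1) m
toℚᵘ-inv m = ℚ.toℚᵘ-fromℚᵘ (mkℚᵘ (+ 1) m)

fromℕ-+ : ∀ m n → fromℕ (m ℕ.+ n) ≡ fromℕ m + fromℕ n
fromℕ-+ m n = ℚ.toℚᵘ-injective (begin
  toℚᵘ (fromℕ (m ℕ.+ n))               ≈⟨ toℚᵘ-fromℕ (m ℕ.+ n) ⟩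
  mkℚᵘ (+ (m ℕ.+ n)) 0                 ≈⟨ *≡* (cong (ℤ._* + 1) +[m+n]≡+m*1++n*1) ⟩
  mkℚᵘ (+ m) 0 ℚᵘ.+ mkℚᵘ (+ n) 0       ≈⟨ ℚᵘ.≃-sym (ℚᵘ.+-cong (toℚᵘ-fromℕ m) (toℚᵘ-fromℕ n)) ⟩
  toℚᵘ (fromℕ m) ℚᵘ.+ toℚᵘ (fromℕ n)   ≈⟨ ℚᵘ.≃-sym (ℚ.toℚᵘ-homo-+ (fromℕ m) (fromℕ n)) ⟩
  toℚᵘ (fromℕ m + fromℕ n)             ∎)
  where
  open ℚᵘ.≃-Reasoning
  +[m+n]≡+m*1++n*1 : + (m ℕ.+ n) ≡ + m ℤ.* + 1 ℤ.+ + n ℤ.* + 1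
  +[m+n]≡+m*1++n*1 = trans (ℤ.pos-+ m n) (sym (cong₂ ℤ._+_ (ℤ.*-identityʳ (+ m)) (ℤ.*-identityʳ (+ n))))

fromℕ-* : ∀ m n → fromℕ (m ℕ.* n) ≡ fromℕ m * fromℕ n
fromℕ-* m n = ℚ.toℚᵘ-injective (begin
  toℚᵘ (fromℕ (m ℕ.* n))               ≈⟨ toℚᵘ-fromℕ (m ℕ.* n) ⟩
  mkℚᵘ (+ (m ℕ.* n)) 0                 ≈⟨ *≡* (cong (ℤ._* + 1) (ℤ.pos-* m n)) ⟩
  mkℚᵘ (+ m) 0 ℚᵘ.* mkℚᵘ (+ n) 0       ≈⟨ ℚᵘ.≃-sym (ℚᵘ.*-cong (toℚᵘ-fromℕ m) (toℚᵘ-fromℕ n)) ⟩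
  toℚᵘ (fromℕ m) ℚᵘ.* toℚᵘ (fromℕ n)   ≈⟨ ℚᵘ.≃-sym (ℚ.toℚᵘ-homo-* (fromℕ m) (fromℕ n)) ⟩
  toℚᵘ (fromℕ m * fromℕ n)             ∎)
  where open ℚᵘ.≃-Reasoning

fromℕ-suc : ∀ n → fromℕ (suc n) ≡ fromℕ n + 1ℚ
fromℕ-suc n = trans (cong fromℕ (ℕ.+-comm 1 n)) (fromℕ-+ n 1)

inv*fromℕ≡1 : ∀ {m} → 1 ≤ m → inv m * fromℕ m ≡ 1ℚ
inv*fromℕ≡1 {suc m} _ = ℚ.toℚᵘ-injective (begin
  toℚᵘ (inv (suc m) * fromℕ (suc m))              ≈⟨ ℚ.toℚᵘ-homo-* (inv (suc m)) (fromℕ (suc m)) ⟩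
  toℚᵘ (inv (suc m)) ℚᵘ.* toℚᵘ (fromℕ (suc m))    ≈⟨ ℚᵘ.*-cong (toℚᵘ-inv m) (toℚᵘ-fromℕ (suc m)) ⟩
  mkℚᵘ (+ 1) m ℚᵘ.* mkℚᵘ (+ suc m) 0               ≈⟨ *≡* (ℤ.*-assoc (+ 1) (+ suc m) (+ 1)) ⟩
  mkℚᵘ (+ 1) 0                                     ∎)
  where open ℚᵘ.≃-Reasoning

0≤fromℕ : ∀ n → 0ℚ ℚ.≤ fromℕ n
0≤fromℕ n = ℚ.nonNegative⁻¹ (fromℕ n) {{ℚ.normalize-nonNeg n 1}}

0<inv : ∀ m → 0ℚ ℚ.< inv (suc m)
0<inv m = ℚ.positive⁻¹ (inv (suc m)) {{ℚ.normalize-pos 1 (suc m)}}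

0≤inv : ∀ m → 0ℚ ℚ.≤ inv m
0≤inv zero    = ℚ.≤-refl
0≤inv (suc m) = ℚ.<⇒≤ (0<inv m)

0≤fromℕ*inv : ∀ a c → 0ℚ ℚ.≤ fromℕ a * inv c
0≤fromℕ*inv a c = ℚ.nonNegative⁻¹ _ {{ℚ.nonNeg*nonNeg⇒nonNeg (fromℕ a) {{ℚ.nonNegative (0≤fromℕ a)}} (inv c) {{ℚ.nonNegative (0≤inv c)}}}}

fromℕ-mono-≤ : ∀ {m n} → m ≤ n → fromℕ m ℚ.≤ fromℕ n
fromℕ-mono-≤ {m} {n} m≤n = begin
  fromℕ m                    ≤⟨ p≤p+q {fromℕ m} (0≤fromℕ (n ℕ.∸ m)) ⟩
  fromℕ m + fromℕ (n ℕ.∸ m)  ≡⟨ fromℕ-+ m (n ℕ.∸ m) ⟨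
  fromℕ (m ℕ.+ (n ℕ.∸ m))    ≡⟨ cong fromℕ (ℕ.m+[n∸m]≡n m≤n) ⟩
  fromℕ n                    ∎
  where open ℚ.≤-Reasoning

fromℕ-mono-< : ∀ {m n} → m < n → fromℕ m ℚ.< fromℕ n
fromℕ-mono-< {m} {n} m<n = begin-strict
  fromℕ m          ≡⟨ ℚ.+-identityʳ (fromℕ m) ⟨
  fromℕ m + 0ℚ     <⟨ ℚ.+-monoʳ-< (fromℕ m) (ℚ.positive⁻¹ 1ℚ) ⟩
  fromℕ m + 1ℚ     ≡⟨ fromℕ-suc m ⟨
  fromℕ (suc m)    ≤⟨ fromℕ-mono-≤ m<n ⟩
  fromℕ n          ∎
  where open ℚ.≤-Reasoning

inv-* : ∀ {m n} → 1 ≤ m → 1 ≤ n → inv (m ℕ.* n) ≡ inv m * inv n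
inv-* {m} {n} 1≤m 1≤n = begin
  w
    ≡⟨ solve 1 (λ w → w := w :* (con 1ℚ :* con 1ℚ)) refl w ⟩
  w * (1ℚ * 1ℚ)
    ≡⟨ cong₂ (λ x y → w * (x * y)) (inv*fromℕ≡1 1≤m) (inv*fromℕ≡1 1≤n) ⟨
  w * ((inv m * fromℕ m) * (inv n * fromℕ n))
    ≡⟨ solve 5 (λ w u v x y → w :* ((u :* x) :* (v :* y)) := (w :* (x :* y)) :* (u :* v)) refl w (inv m) (inv n) (fromℕ m) (fromℕ n) ⟩
  (w * (fromℕ m * fromℕ n)) * (inv m * inv n)
    ≡⟨ cong (λ x → (w * x) * (inv m * inv n)) (fromℕ-* m n) ⟨
  (w * fromℕ (m ℕ.* n)) * (inv m * inv n)
    ≡⟨ cong (_* (inv m * inv n)) (inv*fromℕ≡1 (ℕ.*-mono-≤ 1≤m 1≤n)) ⟩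
  1ℚ * (inv m * inv n)
    ≡⟨ ℚ.*-identityˡ (inv m * inv n) ⟩
  inv m * inv n
    ∎
  where
  open ≡-Reasoning
  w = inv (m ℕ.* n)

fromℕ*inv[m*n] : ∀ {m n} → 1 ≤ m → 1 ≤ n → fromℕ m * inv (m ℕ.* n) ≡ inv n
fromℕ*inv[m*n] {m} {n} 1≤m 1≤n = begin
  fromℕ m * inv (m ℕ.* n)        ≡⟨ cong (fromℕ m *_) (inv-* 1≤m 1≤n) ⟩
  fromℕ m * (inv m * inv n)      ≡⟨ solve 3 (λ x y z → x :* (y :* z) := (y :* x) :* z) refl (fromℕ m) (inv m) (inv n) ⟩
  (inv m * fromℕ m) * inv n      ≡⟨ cong (_* inv n) (inv*fromℕ≡1 1≤m) ⟩
  1ℚ * inv n                     ≡⟨ ℚ.*-identityˡ (inv n) ⟩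
  inv n                          ∎
  where open ≡-Reasoning

inv*fromℕ*inv[m+k] : ∀ {m} k → 1 ≤ m → inv m * (fromℕ k * inv (m ℕ.+ k)) ≡ inv m - inv (m ℕ.+ k)
inv*fromℕ*inv[m+k] {m} k 1≤m = begin
  inv m * (fromℕ k * inv (m ℕ.+ k))
    ≡⟨ cong (λ x → inv m * (x * inv (m ℕ.+ k))) k≡[m+k]-m ⟩
  inv m * ((fromℕ (m ℕ.+ k) - fromℕ m) * inv (m ℕ.+ k))
    ≡⟨ solve 4 (λ u v x y → u :* ((y :- x) :* v) := (v :* y) :* u :- (u :* x) :* v) refl (inv m) (inv (m ℕ.+ k)) (fromℕ m) (fromℕ (m ℕ.+ k)) ⟩
  (inv (m ℕ.+ k) * fromℕ (m ℕ.+ k)) * inv m - (inv m * fromℕ m) * inv (m ℕ.+ k)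
    ≡⟨ cong₂ (λ x y → x * inv m - y * inv (m ℕ.+ k)) (inv*fromℕ≡1 (ℕ.≤-trans 1≤m (ℕ.m≤m+n m k))) (inv*fromℕ≡1 1≤m) ⟩
  1ℚ * inv m - 1ℚ * inv (m ℕ.+ k)
    ≡⟨ cong₂ _-_ (ℚ.*-identityˡ (inv m)) (ℚ.*-identityˡ (inv (m ℕ.+ k))) ⟩
  inv m - inv (m ℕ.+ k)
    ∎
  where
  open ≡-Reasoning
  k≡[m+k]-m : fromℕ k ≡ fromℕ (m ℕ.+ k) - fromℕ m
  k≡[m+k]-m = sym (trans (cong (_- fromℕ m) (fromℕ-+ m k)) (solve 2 (λ x y → x :+ y :- x := y) refl (fromℕ m) (fromℕ k)))

inv[m*[m+1]] : ∀ {m} → 1 ≤ m → inv (m ℕ.* (m ℕ.+ 1)) ≡ inv m - inv (suc m)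
inv[m*[m+1]] {m} 1≤m = begin
  inv (m ℕ.* (m ℕ.+ 1))               ≡⟨ inv-* 1≤m (ℕ.m≤n+m 1 m) ⟩
  inv m * inv (m ℕ.+ 1)               ≡⟨ cong (inv m *_) (ℚ.*-identityˡ (inv (m ℕ.+ 1))) ⟨
  inv m * (fromℕ 1 * inv (m ℕ.+ 1))   ≡⟨ inv*fromℕ*inv[m+k] 1 1≤m ⟩
  inv m - inv (m ℕ.+ 1)               ≡⟨ cong (λ x → inv m - inv x) (ℕ.+-comm m 1) ⟩
  inv m - inv (suc m)                 ∎
  where open ≡-Reasoning

fromℕ*inv*fromℕ : ∀ a {c} → 1 ≤ c → ∀ c' → (fromℕ a * inv c) * (fromℕ c * fromℕ c') ≡ fromℕ (a ℕ.* c')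
fromℕ*inv*fromℕ a {c} 1≤c c' = begin
  (fromℕ a * inv c) * (fromℕ c * fromℕ c') ≡⟨ solve 4 (λ a i c d → (a :* i) :* (c :* d) := (i :* c) :* (a :* d)) refl (fromℕ a) (inv c) (fromℕ c) (fromℕ c') ⟩
  (inv c * fromℕ c) * (fromℕ a * fromℕ c') ≡⟨ cong (_* (fromℕ a * fromℕ c')) (inv*fromℕ≡1 1≤c) ⟩
  1ℚ * (fromℕ a * fromℕ c')                ≡⟨ ℚ.*-identityˡ _ ⟩
  fromℕ a * fromℕ c'                       ≡⟨ fromℕ-* a c' ⟨
  fromℕ (a ℕ.* c')                         ∎
  where open ≡-Reasoning

module _ (a c a' c' : ℕ) (1≤c : 1 ≤ c) (1≤c' : 1 ≤ c') where

  private
    P = fromℕ c * fromℕ c'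

    instance
      P-pos : ℚ.Positive P
      P-pos = ℚ.pos*pos⇒pos (fromℕ c) {{ℚ.positive (fromℕ-mono-< 1≤c)}} (fromℕ c') {{ℚ.positive (fromℕ-mono-< 1≤c')}}

      P-nonNeg : ℚ.NonNegative P
      P-nonNeg = ℚ.pos⇒nonNeg P

    lhs*P : (fromℕ a * inv c) * P ≡ fromℕ (a ℕ.* c')
    lhs*P = fromℕ*inv*fromℕ a 1≤c c'

    rhs*P : (fromℕ a' * inv c') * P ≡ fromℕ (a' ℕ.* c)
    rhs*P = trans (cong ((fromℕ a' * inv c') *_) (ℚ.*-comm (fromℕ c) (fromℕ c'))) (fromℕ*inv*fromℕ a' 1≤c' c)

  fraction-mono-< : a ℕ.* c' < a' ℕ.* c → fromℕ a * inv c ℚ.< fromℕ a' * inv c'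
  fraction-mono-< lt = ℚ.*-cancelʳ-<-nonNeg P (subst₂ ℚ._<_ (sym lhs*P) (sym rhs*P) (fromℕ-mono-< lt))

  fraction-mono-≤ : a ℕ.* c' ≤ a' ℕ.* c → fromℕ a * inv c ℚ.≤ fromℕ a' * inv c'
  fraction-mono-≤ le = ℚ.*-cancelʳ-≤-pos P (subst₂ ℚ._≤_ (sym lhs*P) (sym rhs*P) (fromℕ-mono-≤ le))

inv-antimono-≤ : ∀ {m n} → 1 ≤ m → m ≤ n → inv n ℚ.≤ inv m
inv-antimono-≤ {m} {n} 1≤m m≤n = subst₂ ℚ._≤_ (ℚ.*-identityˡ (inv n)) (ℚ.*-identityˡ (inv m))
  (fraction-mono-≤ 1 n 1 m (ℕ.≤-trans 1≤m m≤n) 1≤m (ℕ.*-monoʳ-≤ 1 m≤n))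

-- For ε = (1 + p) / (1 + d) every n > a (1 + d) works.
fromℕ*inv-eventually-< : ∀ a ε → 0ℚ ℚ.< ε → ∃[ K ] (1 ≤ K × (∀ n → K ≤ n → fromℕ a * inv n ℚ.< ε))
fromℕ*inv-eventually-< a (mkℚ (+ zero)   d _) (ℚ.*<* (ℤ.+<+ ()))
fromℕ*inv-eventually-< a (mkℚ ℤ.-[1+ p ] d _) (ℚ.*<* ())
fromℕ*inv-eventually-< a (mkℚ (+ suc p)  d cop) _ = suc (a ℕ.* suc d) , s≤s z≤n , λ n K≤n →
  subst (fromℕ a * inv n ℚ.<_) (sym ε≡) (fraction-mono-< a n (suc p) (suc d) (ℕ.≤-trans (s≤s z≤n) K≤n) (s≤s z≤n)
    (ℕ.<-≤-trans K≤n (ℕ.m≤n*m n (suc p))))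
  where
  ε≡ : mkℚ (+ suc p) d cop ≡ fromℕ (suc p) * inv (suc d)
  ε≡ = ℚ.toℚᵘ-injective (ℚᵘ.≃-sym (begin
    toℚᵘ (fromℕ (suc p) * inv (suc d))               ≈⟨ ℚ.toℚᵘ-homo-* (fromℕ (suc p)) (inv (suc d)) ⟩
    toℚᵘ (fromℕ (suc p)) ℚᵘ.* toℚᵘ (inv (suc d))     ≈⟨ ℚᵘ.*-cong (toℚᵘ-fromℕ (suc p)) (toℚᵘ-inv d) ⟩
    mkℚᵘ (+ suc p) 0 ℚᵘ.* mkℚᵘ (+ 1) d                ≈⟨ *≡* (ℤ.*-assoc (+ suc p) (+ 1) (+ suc d)) ⟩
    mkℚᵘ (+ suc p) d                                  ∎))
    where open ℚᵘ.≃-Reasoning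

sumFrom : (ℕ → ℚ) → ℕ → ℕ → ℚ
sumFrom f a zero    = 0ℚ
sumFrom f a (suc c) = sumFrom f a c + f (a ℕ.+ c)

sum1≡sumFrom : ∀ f M → sum1 f M ≡ sumFrom f 1 M
sum1≡sumFrom f zero    = refl
sum1≡sumFrom f (suc M) = cong (_+ f (suc M)) (sum1≡sumFrom f M)

sum1-cong : ∀ {f g} M → (∀ n → 1 ≤ n → f n ≡ g n) → sum1 f M ≡ sum1 g M
sum1-cong zero    f≡g = refl
sum1-cong (suc M) f≡g = cong₂ _+_ (sum1-cong M f≡g) (f≡g (suc M) (s≤s z≤n))

sum1-sub : ∀ f g M → sum1 (λ n → f n - g n) M ≡ sum1 f M - sum1 g M
sum1-sub f g zero    = refl
sum1-sub f g (suc M) = trans (cong (_+ (f (suc M) - g (suc M))) (sum1-sub f g M))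
  (solve 4 (λ x y z w → (x :- y) :+ (z :- w) := (x :+ z) :- (y :+ w)) refl (sum1 f M) (sum1 g M) (f (suc M)) (g (suc M)))

sum1-*ˡ : ∀ x f M → sum1 (λ n → x * f n) M ≡ x * sum1 f M
sum1-*ˡ x f zero    = sym (ℚ.*-zeroʳ x)
sum1-*ˡ x f (suc M) = trans (cong (_+ x * f (suc M)) (sum1-*ˡ x f M)) (sym (ℚ.*-distribˡ-+ x (sum1 f M) (f (suc M))))

sum1-+ : ∀ f g M → sum1 (λ n → f n + g n) M ≡ sum1 f M + sum1 g M
sum1-+ f g zero    = refl
sum1-+ f g (suc M) = trans (cong (_+ (f (suc M) + g (suc M))) (sum1-+ f g M))
  (solve 4 (λ x y z w → (x :+ y) :+ (z :+ w) := (x :+ z) :+ (y :+ w)) refl (sum1 f M) (sum1 g M) (f (suc M)) (g (suc M)))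

sumFrom-cong : ∀ {f g} a c → (∀ k → k < c → f (a ℕ.+ k) ≡ g (a ℕ.+ k)) → sumFrom f a c ≡ sumFrom g a c
sumFrom-cong a zero    f≡g = refl
sumFrom-cong a (suc c) f≡g = cong₂ _+_ (sumFrom-cong a c (λ k k<c → f≡g k (ℕ.m<n⇒m<1+n k<c))) (f≡g c ℕ.≤-refl)

sumFrom-sub : ∀ f g a c → sumFrom (λ i → f i - g i) a c ≡ sumFrom f a c - sumFrom g a c
sumFrom-sub f g a zero    = refl
sumFrom-sub f g a (suc c) = trans (cong (_+ (f (a ℕ.+ c) - g (a ℕ.+ c))) (sumFrom-sub f g a c))
  (solve 4 (λ x y z w → (x :- y) :+ (z :- w) := (x :+ z) :- (y :+ w)) refl (sumFrom f a c) (sumFrom g a c) (f (a ℕ.+ c)) (g (a ℕ.+ c)))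

sumFrom-*ˡ : ∀ x f a c → sumFrom (λ i → x * f i) a c ≡ x * sumFrom f a c
sumFrom-*ˡ x f a zero    = sym (ℚ.*-zeroʳ x)
sumFrom-*ˡ x f a (suc c) = trans (cong (_+ x * f (a ℕ.+ c)) (sumFrom-*ˡ x f a c)) (sym (ℚ.*-distribˡ-+ x (sumFrom f a c) (f (a ℕ.+ c))))

sumFrom-const : ∀ x a c → sumFrom (λ _ → x) a c ≡ fromℕ c * x
sumFrom-const x a zero    = sym (ℚ.*-zeroˡ x)
sumFrom-const x a (suc c) = begin
  sumFrom (λ _ → x) a c + x  ≡⟨ cong (_+ x) (sumFrom-const x a c) ⟩
  fromℕ c * x + x            ≡⟨ solve 2 (λ y x → y :* x :+ x := (y :+ con 1ℚ) :* x) refl (fromℕ c) x ⟩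
  (fromℕ c + 1ℚ) * x         ≡⟨ cong (_* x) (fromℕ-suc c) ⟨
  fromℕ (suc c) * x          ∎
  where open ≡-Reasoning

sumFrom-telescope : ∀ (h : ℕ → ℚ) a c → sumFrom (λ i → h i - h (suc i)) a c ≡ h a - h (a ℕ.+ c)
sumFrom-telescope h a zero    = trans (sym (ℚ.+-inverseʳ (h a))) (cong (λ i → h a - h i) (sym (ℕ.+-identityʳ a)))
sumFrom-telescope h a (suc c) = begin
  sumFrom (λ i → h i - h (suc i)) a c + (h (a ℕ.+ c) - h (suc (a ℕ.+ c)))
    ≡⟨ cong (_+ (h (a ℕ.+ c) - h (suc (a ℕ.+ c)))) (sumFrom-telescope h a c) ⟩
  h a - h (a ℕ.+ c) + (h (a ℕ.+ c) - h (suc (a ℕ.+ c)))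
    ≡⟨ solve 3 (λ x y z → x :- y :+ (y :- z) := x :- z) refl (h a) (h (a ℕ.+ c)) (h (suc (a ℕ.+ c))) ⟩
  h a - h (suc (a ℕ.+ c))
    ≡⟨ cong (λ i → h a - h i) (ℕ.+-suc a c) ⟨
  h a - h (a ℕ.+ suc c)
    ∎
  where open ≡-Reasoning

sumFrom-head : ∀ f a c → sumFrom f a (suc c) ≡ f a + sumFrom f (suc a) c
sumFrom-head f a zero    = trans (ℚ.+-identityˡ (f (a ℕ.+ 0))) (trans (cong f (ℕ.+-identityʳ a)) (sym (ℚ.+-identityʳ (f a))))
sumFrom-head f a (suc c) = begin
  sumFrom f a (suc c) + f (a ℕ.+ suc c)       ≡⟨ cong₂ _+_ (sumFrom-head f a c) (cong f (ℕ.+-suc a c)) ⟩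
  f a + sumFrom f (suc a) c + f (suc a ℕ.+ c) ≡⟨ ℚ.+-assoc (f a) _ _ ⟩
  f a + sumFrom f (suc a) (suc c)             ∎
  where open ≡-Reasoning

sumFrom-++ : ∀ f a c d → sumFrom f a (c ℕ.+ d) ≡ sumFrom f a c + sumFrom f (a ℕ.+ c) d
sumFrom-++ f a c zero    = trans (cong (sumFrom f a) (ℕ.+-identityʳ c)) (sym (ℚ.+-identityʳ _))
sumFrom-++ f a c (suc d) = begin
  sumFrom f a (c ℕ.+ suc d)                             ≡⟨ cong (sumFrom f a) (ℕ.+-suc c d) ⟩
  sumFrom f a (c ℕ.+ d) + f (a ℕ.+ (c ℕ.+ d))           ≡⟨ cong₂ _+_ (sumFrom-++ f a c d) (cong f (sym (ℕ.+-assoc a c d))) ⟩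
  sumFrom f a c + sumFrom f (a ℕ.+ c) d + f (a ℕ.+ c ℕ.+ d) ≡⟨ ℚ.+-assoc (sumFrom f a c) _ _ ⟩
  sumFrom f a c + sumFrom f (a ℕ.+ c) (suc d)           ∎
  where open ≡-Reasoning

sumFrom-shift : ∀ f a c → sumFrom f a c ≡ sumFrom (λ k → f (a ℕ.+ k)) 0 c
sumFrom-shift f a zero    = refl
sumFrom-shift f a (suc c) = cong (_+ f (a ℕ.+ c)) (sumFrom-shift f a c)

sumFrom-mono-≤ : ∀ {f g} a c → (∀ k → k < c → f (a ℕ.+ k) ℚ.≤ g (a ℕ.+ k)) → sumFrom f a c ℚ.≤ sumFrom g a c
sumFrom-mono-≤ a zero    f≤g = ℚ.≤-refl
sumFrom-mono-≤ a (suc c) f≤g = ℚ.+-mono-≤ (sumFrom-mono-≤ a c (λ k k<c → f≤g k (ℕ.m<n⇒m<1+n k<c))) (f≤g c ℕ.≤-refl)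

∣sumFrom∣≤sumFrom∣∣ : ∀ f a c → ∣ sumFrom f a c ∣ ℚ.≤ sumFrom (λ i → ∣ f i ∣) a c
∣sumFrom∣≤sumFrom∣∣ f a zero    = ℚ.≤-refl
∣sumFrom∣≤sumFrom∣∣ f a (suc c) = ℚ.≤-trans (ℚ.∣p+q∣≤∣p∣+∣q∣ (sumFrom f a c) _) (ℚ.+-monoˡ-≤ _ (∣sumFrom∣≤sumFrom∣∣ f a c))

∣sumFrom∣≤length*bound : ∀ f x a c → (∀ k → k < c → ∣ f (a ℕ.+ k) ∣ ℚ.≤ x) → ∣ sumFrom f a c ∣ ℚ.≤ fromℕ c * x
∣sumFrom∣≤length*bound f x a c ∣f∣≤x = ℚ.≤-trans (∣sumFrom∣≤sumFrom∣∣ f a c)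
  (subst (sumFrom (λ i → ∣ f i ∣) a c ℚ.≤_) (sumFrom-const x a c) (sumFrom-mono-≤ a c ∣f∣≤x))

∣sumFrom∣≤telescope : ∀ f (h : ℕ → ℚ) a c → (∀ k → k < c → ∣ f (a ℕ.+ k) ∣ ℚ.≤ h (a ℕ.+ k) - h (suc (a ℕ.+ k))) →
  ∣ sumFrom f a c ∣ ℚ.≤ h a - h (a ℕ.+ c)
∣sumFrom∣≤telescope f h a c ∣f∣≤Δh = ℚ.≤-trans (∣sumFrom∣≤sumFrom∣∣ f a c)
  (subst (sumFrom (λ i → ∣ f i ∣) a c ℚ.≤_) (sumFrom-telescope h a c) (sumFrom-mono-≤ a c ∣f∣≤Δh))

signPow-+ : ∀ m n → signPow (m ℕ.+ n) ≡ signPow m * signPow n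
signPow-+ zero    n = sym (ℚ.*-identityˡ _)
signPow-+ (suc m) n = trans (cong -_ (signPow-+ m n)) (ℚ.neg-distribˡ-* (signPow m) (signPow n))

∣signPow∣≡1 : ∀ k → ∣ signPow k ∣ ≡ 1ℚ
∣signPow∣≡1 zero    = refl
∣signPow∣≡1 (suc k) = trans (ℚ.∣-p∣≡∣p∣ (signPow k)) (∣signPow∣≡1 k)

∣signPow*p∣≡∣p∣ : ∀ k p → ∣ signPow k * p ∣ ≡ ∣ p ∣
∣signPow*p∣≡∣p∣ k p = trans (ℚ.∣p*q∣≡∣p∣*∣q∣ (signPow k) p) (trans (cong (_* ∣ p ∣) (∣signPow∣≡1 k)) (ℚ.*-identityˡ _))

δ : ℕ → ℕ → ℕ
δ j k = if does (k ℕ.≟ j) then 1 else 0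

module _ {B} (2≤B : 2 ≤ B) {j} (1≤j : 1 ≤ j) where

  private
    instance
      B-nonZero : ℕ.NonZero B
      B-nonZero = ℕ.>-nonZero (ℕ.≤-trans (s≤s z≤n) 2≤B)

    count : Expansion B → ℕ
    count ds = length (filter (λ d → toℕ d ℕ.≟ j) ds)

    count-∷ : ∀ d ds → count (d ∷ ds) ≡ δ j (toℕ d) ℕ.+ count ds
    count-∷ d ds with does (toℕ d ℕ.≟ j)
    ... | true  = refl
    ... | false = refl

    δ[0]≡0 : δ j 0 ≡ 0
    δ[0]≡0 = δ[0,1+i]≡0 1≤j
      where
      δ[0,1+i]≡0 : ∀ {i} → 1 ≤ i → δ i 0 ≡ 0
      δ[0,1+i]≡0 (s≤s _) = refl

    lastDigit : ∀ (d : Fin B) v → (toℕ d ℕ.+ v ℕ.* B) % B ≡ toℕ d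
    lastDigit d v = trans ([m+kn]%n≡m%n (toℕ d) v B) (m<n⇒m%n≡m (Fin.toℕ<n d))

    -- Expansions of the same number differ only by zeros at the end of the list, and j ≠ 0.
    count-zero : ∀ ds → fromDigits ds ≡ 0 → count ds ≡ 0
    count-zero []       _  = refl
    count-zero (d ∷ ds) ≡0 = trans (count-∷ d ds) (cong₂ ℕ._+_
      (trans (cong (δ j) (ℕ.m+n≡0⇒m≡0 (toℕ d) ≡0)) δ[0]≡0)
      (count-zero ds (ℕ.m*n≡0⇒m≡0 (fromDigits ds) B (ℕ.m+n≡0⇒n≡0 (toℕ d) ≡0))))

    count-cong : ∀ ds ds' → fromDigits ds ≡ fromDigits ds' → count ds ≡ count ds'
    count-cong []       ds'        eq = sym (count-zero ds' (sym eq))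
    count-cong (d ∷ ds) []         eq = count-zero (d ∷ ds) eq
    count-cong (d ∷ ds) (d' ∷ ds') eq = begin
      count (d ∷ ds)             ≡⟨ count-∷ d ds ⟩
      δ j (toℕ d) ℕ.+ count ds   ≡⟨ cong₂ ℕ._+_ (cong (δ j) d≡d') (count-cong ds ds' ds≡ds') ⟩
      δ j (toℕ d') ℕ.+ count ds' ≡⟨ count-∷ d' ds' ⟨
      count (d' ∷ ds')           ∎
      where
      open ≡-Reasoning
      d≡d' : toℕ d ≡ toℕ d'
      d≡d' = trans (sym (lastDigit d (fromDigits ds))) (trans (cong (_% B) eq) (lastDigit d' (fromDigits ds')))
      ds≡ds' : fromDigits ds ≡ fromDigits ds'
      ds≡ds' = ℕ.*-cancelʳ-≡ (fromDigits ds) (fromDigits ds') B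
        (ℕ.+-cancelˡ-≡ (toℕ d) _ _ (trans eq (cong (ℕ._+ fromDigits ds' ℕ.* B) (sym d≡d'))))

    digits : ℕ → Expansion B
    digits n = proj₁ (toDigits B {fromWitness 2≤B} n)

    fromDigits-digits : ∀ n → fromDigits (digits n) ≡ n
    fromDigits-digits n = proj₂ (toDigits B {fromWitness 2≤B} n)

  digitCount-zero : digitCount B 2≤B j 0 ≡ 0
  digitCount-zero = count-zero (digits 0) (fromDigits-digits 0)

  digitCount-step : ∀ n {k} (k<B : k < B) → digitCount B 2≤B j (B ℕ.* n ℕ.+ k) ≡ δ j k ℕ.+ digitCount B 2≤B j n
  digitCount-step n {k} k<B = begin
    count (digits (B ℕ.* n ℕ.+ k))         ≡⟨ count-cong (digits (B ℕ.* n ℕ.+ k)) (fromℕ< k<B ∷ digits n) (trans (fromDigits-digits _) (sym value)) ⟩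
    count (fromℕ< k<B ∷ digits n)          ≡⟨ count-∷ (fromℕ< k<B) (digits n) ⟩
    δ j (toℕ (fromℕ< k<B)) ℕ.+ count (digits n) ≡⟨ cong (λ i → δ j i ℕ.+ count (digits n)) (Fin.toℕ-fromℕ< k<B) ⟩
    δ j k ℕ.+ count (digits n)             ∎
    where
    open ≡-Reasoning
    value : fromDigits (fromℕ< k<B ∷ digits n) ≡ B ℕ.* n ℕ.+ k
    value = begin
      toℕ (fromℕ< k<B) ℕ.+ fromDigits (digits n) ℕ.* B ≡⟨ cong₂ (λ x y → x ℕ.+ y ℕ.* B) (Fin.toℕ-fromℕ< k<B) (fromDigits-digits n) ⟩
      k ℕ.+ n ℕ.* B                                    ≡⟨ ℕ.+-comm k _ ⟩
      n ℕ.* B ℕ.+ k                                    ≡⟨ cong (ℕ._+ k) (ℕ.*-comm n B) ⟩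
      B ℕ.* n ℕ.+ k                                    ∎

TendsToZero : (ℕ → ℚ) → Set
TendsToZero e = ∀ ε → 0ℚ ℚ.< ε → ∃[ N ] (∀ M → N ≤ M → ∣ e M ∣ ℚ.< ε)

tendsToZero-≤ : ∀ {e e'} → (∀ M → ∣ e M ∣ ℚ.≤ ∣ e' M ∣) → TendsToZero e' → TendsToZero e
tendsToZero-≤ ∣e∣≤∣e'∣ e'→0 ε 0<ε with e'→0 ε 0<ε
... | N , small = N , λ M N≤M → ℚ.≤-<-trans (∣e∣≤∣e'∣ M) (small M N≤M)

tendsToZero-≤fromℕ*inv : ∀ {e} c → (∀ M → ∣ e M ∣ ℚ.≤ fromℕ c * inv (suc M)) → TendsToZero e
tendsToZero-≤fromℕ*inv c ∣e∣≤c/[1+M] ε 0<ε with fromℕ*inv-eventually-< c ε 0<ε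
... | K , _ , small = K , λ M K≤M → ℚ.≤-<-trans (∣e∣≤c/[1+M] M) (small (suc M) (ℕ.≤-trans K≤M (ℕ.n≤1+n M)))

ε*½+ε*½≡ε : ∀ ε → ε * ½ + ε * ½ ≡ ε
ε*½+ε*½≡ε = solve 1 (λ ε → ε :* con ½ :+ ε :* con ½ := ε) refl

module Contraction (b' : ℕ) (e : ℕ → ℚ) (C : ℕ) (bounded : ∀ N → ∣ e N ∣ ℚ.≤ fromℕ C)
  (contracts : ∀ N r → 1 ≤ N → r < 2 ℕ.+ b' →
    ∣ e ((2 ℕ.+ b') ℕ.* N ℕ.+ r) ∣ ℚ.≤ fromℕ b' * inv (2 ℕ.+ b') * ∣ e N ∣ + (inv N + inv N))
  where

  private
    B = 2 ℕ.+ b'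
    ρ = fromℕ b' * inv B

    1≤B : 1 ≤ B
    1≤B = s≤s z≤n

    0≤ρ : 0ℚ ℚ.≤ ρ
    0≤ρ = 0≤fromℕ*inv b' B

    ρ*B≡b' : ρ * fromℕ B ≡ fromℕ b'
    ρ*B≡b' = trans (ℚ.*-assoc (fromℕ b') (inv B) (fromℕ B)) (trans (cong (fromℕ b' *_) (inv*fromℕ≡1 1≤B)) (ℚ.*-identityʳ (fromℕ b')))

    -- ρ^t C ≤ V t, a bound decaying like 1/t that avoids powers of ρ.
    V : ℕ → ℚ
    V t = fromℕ (C ℕ.* B) * inv (B ℕ.+ 2 ℕ.* t)

    1≤B+2t : ∀ t → 1 ≤ B ℕ.+ 2 ℕ.* t
    1≤B+2t t = ℕ.≤-trans 1≤B (ℕ.m≤m+n B (2 ℕ.* t))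

    C≤V0 : fromℕ C ℚ.≤ V 0
    C≤V0 = begin
      fromℕ C                 ≡⟨ ℚ.*-identityʳ (fromℕ C) ⟨
      fromℕ C * inv 1         ≤⟨ fraction-mono-≤ C 1 (C ℕ.* B) (B ℕ.+ 2 ℕ.* 0) (s≤s z≤n) (1≤B+2t 0) (ℕ.≤-reflexive (C*[B+0]≡C*B*1 C B)) ⟩
      V 0                     ∎
      where
      open ℚ.≤-Reasoning
      C*[B+0]≡C*B*1 : ∀ C B → C ℕ.* (B ℕ.+ 2 ℕ.* 0) ≡ C ℕ.* B ℕ.* 1
      C*[B+0]≡C*B*1 = solve-∀

    ρV≤V : ∀ t → ρ * V t ℚ.≤ V (suc t)
    ρV≤V t = begin
      fromℕ b' * inv B * (fromℕ (C ℕ.* B) * inv (B ℕ.+ 2 ℕ.* t))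
        ≡⟨ solve 4 (λ a i c k → a :* i :* (c :* k) := (a :* c) :* (i :* k)) refl (fromℕ b') (inv B) (fromℕ (C ℕ.* B)) (inv (B ℕ.+ 2 ℕ.* t)) ⟩
      (fromℕ b' * fromℕ (C ℕ.* B)) * (inv B * inv (B ℕ.+ 2 ℕ.* t))
        ≡⟨ cong₂ _*_ (fromℕ-* b' (C ℕ.* B)) (inv-* 1≤B (1≤B+2t t)) ⟨
      fromℕ (b' ℕ.* (C ℕ.* B)) * inv (B ℕ.* (B ℕ.+ 2 ℕ.* t))
        ≤⟨ fraction-mono-≤ (b' ℕ.* (C ℕ.* B)) (B ℕ.* (B ℕ.+ 2 ℕ.* t)) (C ℕ.* B) (B ℕ.+ 2 ℕ.* suc t) (ℕ.*-mono-≤ 1≤B (1≤B+2t t)) (1≤B+2t (suc t))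
             (subst (b' ℕ.* (C ℕ.* B) ℕ.* (B ℕ.+ 2 ℕ.* suc t) ≤_) (sym (expand b' (C ℕ.* B) t)) (ℕ.m≤m+n _ _)) ⟩
      V (suc t)
        ∎
      where
      open ℚ.≤-Reasoning
      expand : ∀ b' X t → X ℕ.* ((2 ℕ.+ b') ℕ.* ((2 ℕ.+ b') ℕ.+ 2 ℕ.* t)) ≡ b' ℕ.* X ℕ.* ((2 ℕ.+ b') ℕ.+ 2 ℕ.* suc t) ℕ.+ X ℕ.* (4 ℕ.+ 4 ℕ.* t)
      expand = solve-∀

    -- ρ B + 2 = B makes the additive error B/Q a fixed point of the recursion.
    absorb : ∀ v i → ρ * (v + fromℕ B * i) + (i + i) ≡ ρ * v + fromℕ B * i
    absorb v i = begin
      ρ * (v + fromℕ B * i) + (i + i)               ≡⟨ solve 4 (λ r v P i → r :* (v :+ P :* i) :+ (i :+ i) := r :* v :+ (r :* P :+ con (1ℚ + 1ℚ)) :* i) refl ρ v (fromℕ B) i ⟩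
      ρ * v + (ρ * fromℕ B + fromℕ 2) * i           ≡⟨ cong (λ x → ρ * v + (x + fromℕ 2) * i) ρ*B≡b' ⟩
      ρ * v + (fromℕ b' + fromℕ 2) * i              ≡⟨ cong (λ x → ρ * v + x * i) (trans (ℚ.+-comm (fromℕ b') (fromℕ 2)) (sym (fromℕ-+ 2 b'))) ⟩
      ρ * v + fromℕ B * i                           ∎
      where open ≡-Reasoning

    bound : ∀ t {Q} N → 1 ≤ Q → B ℕ.^ t ℕ.* Q ≤ N → ∣ e N ∣ ℚ.≤ V t + fromℕ B * inv Q
    bound zero    {Q} N 1≤Q _ = ℚ.≤-trans (bounded N) (ℚ.≤-trans C≤V0 (p≤p+q (0≤fromℕ*inv B Q)))
    bound (suc t) {Q} N 1≤Q B^[1+t]Q≤N = begin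
      ∣ e N ∣                                    ≡⟨ cong (λ x → ∣ e x ∣) N≡BN'+r ⟩
      ∣ e (B ℕ.* N' ℕ.+ r) ∣                     ≤⟨ contracts N' r 1≤N' (m%n<n N B) ⟩
      ρ * ∣ e N' ∣ + (inv N' + inv N')           ≤⟨ ℚ.+-mono-≤ (ℚ.*-monoˡ-≤-nonNeg ρ {{ℚ.nonNegative 0≤ρ}} (bound t N' 1≤Q B^tQ≤N')) (ℚ.+-mono-≤ 1/N'≤1/Q 1/N'≤1/Q) ⟩
      ρ * (V t + fromℕ B * inv Q) + (inv Q + inv Q) ≡⟨ absorb (V t) (inv Q) ⟩
      ρ * V t + fromℕ B * inv Q                  ≤⟨ ℚ.+-monoˡ-≤ (fromℕ B * inv Q) (ρV≤V t) ⟩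
      V (suc t) + fromℕ B * inv Q                ∎
      where
      open ℚ.≤-Reasoning
      N' = N ℕ./ B
      r = N % B
      N≡BN'+r : N ≡ B ℕ.* N' ℕ.+ r
      N≡BN'+r = trans (m≡m%n+[m/n]*n N B) (trans (ℕ.+-comm r (N' ℕ.* B)) (cong (ℕ._+ r) (ℕ.*-comm N' B)))
      B^tQ≤N' : B ℕ.^ t ℕ.* Q ≤ N'
      B^tQ≤N' = subst (_≤ N') (m*n/n≡m (B ℕ.^ t ℕ.* Q) B)
        (/-monoˡ-≤ B (subst (_≤ N) B^[1+t]Q≡B^tQ*B B^[1+t]Q≤N))
        where
        B^[1+t]Q≡B^tQ*B : B ℕ.^ suc t ℕ.* Q ≡ B ℕ.^ t ℕ.* Q ℕ.* B
        B^[1+t]Q≡B^tQ*B = trans (ℕ.*-assoc B (B ℕ.^ t) Q) (ℕ.*-comm B (B ℕ.^ t ℕ.* Q))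
      Q≤N' : Q ≤ N'
      Q≤N' = ℕ.≤-trans (ℕ.m≤n*m Q (B ℕ.^ t) {{ℕ.m^n≢0 B t}}) B^tQ≤N'
      1≤N' : 1 ≤ N'
      1≤N' = ℕ.≤-trans 1≤Q Q≤N'
      1/N'≤1/Q : inv N' ℚ.≤ inv Q
      1/N'≤1/Q = inv-antimono-≤ 1≤Q Q≤N'

  tendsToZero : TendsToZero e
  tendsToZero ε 0<ε =
    let t , _ , V-small = fromℕ*inv-eventually-< (C ℕ.* B) (ε * ½) 0<ε/2
        Q , 1≤Q , B/Q-small = fromℕ*inv-eventually-< B (ε * ½) 0<ε/2
    in B ℕ.^ t ℕ.* Q , λ N B^tQ≤N → begin-strict
      ∣ e N ∣                      ≤⟨ bound t N 1≤Q B^tQ≤N ⟩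
      V t + fromℕ B * inv Q        <⟨ ℚ.+-mono-< (V-small (B ℕ.+ 2 ℕ.* t) (ℕ.≤-trans (ℕ.m≤n*m t 2) (ℕ.m≤n+m (2 ℕ.* t) B))) (B/Q-small Q ℕ.≤-refl) ⟩
      ε * ½ + ε * ½                ≡⟨ ε*½+ε*½≡ε ε ⟩
      ε                            ∎
    where
    open ℚ.≤-Reasoning
    0<ε/2 : 0ℚ ℚ.< ε * ½
    0<ε/2 = ℚ.positive⁻¹ _ {{ℚ.pos*pos⇒pos ε {{ℚ.positive 0<ε}} ½}}

module DigitSeries (b' : ℕ) {j : ℕ} (1≤j : 1 ≤ j) (j<B : j < 2 ℕ.+ b') where

  private
    B = 2 ℕ.+ b'
    b = suc b'

    1≤B : 1 ≤ B
    1≤B = s≤s z≤n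

    1≤B*n : ∀ {n} → 1 ≤ n → 1 ≤ B ℕ.* n
    1≤B*n = ℕ.*-mono-≤ 1≤B

  2≤B : 2 ≤ B
  2≤B = s≤s (s≤s z≤n)

  sgn : ℕ → ℚ
  sgn n = signPow (digitCount B 2≤B j n)

  σ : ℕ → ℚ
  σ k = signPow (δ j k)

  private
    ∣sgn*p∣≡∣p∣ : ∀ m p → ∣ sgn m * p ∣ ≡ ∣ p ∣
    ∣sgn*p∣≡∣p∣ m = ∣signPow*p∣≡∣p∣ (digitCount B 2≤B j m)

  sgn-step : ∀ n {k} → k < B → sgn (B ℕ.* n ℕ.+ k) ≡ σ k * sgn n
  sgn-step n {k} k<B = trans (cong signPow (digitCount-step 2≤B 1≤j n k<B)) (signPow-+ (δ j k) _)

  sgn-digit : ∀ {k} → k < B → sgn k ≡ σ k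
  sgn-digit {k} k<B = begin
    sgn k                    ≡⟨ cong (λ m → sgn (m ℕ.+ k)) (ℕ.*-zeroʳ B) ⟨
    sgn (B ℕ.* 0 ℕ.+ k)      ≡⟨ sgn-step 0 k<B ⟩
    σ k * sgn 0              ≡⟨ cong (λ i → σ k * signPow i) (digitCount-zero 2≤B 1≤j) ⟩
    σ k * 1ℚ                 ≡⟨ ℚ.*-identityʳ (σ k) ⟩
    σ k                      ∎
    where open ≡-Reasoning

  σ-≢ : ∀ {k} → k ≢ j → σ k ≡ 1ℚ
  σ-≢ {k} k≢j = cong (λ x → signPow (if x then 1 else 0)) (dec-false (k ℕ.≟ j) k≢j)

  σ-j : σ j ≡ - 1ℚ
  σ-j = cong (λ x → signPow (if x then 1 else 0)) (dec-true (j ℕ.≟ j) refl)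

  -- Only the term k = j changes sign, which subtracts it twice.
  sumFrom-σ* : ∀ h {c} → j < c → sumFrom (λ k → σ k * h k) 0 c ≡ sumFrom h 0 c - fromℕ 2 * h j
  sumFrom-σ* h {suc c} j<1+c with ℕ.m≤n⇒m<n∨m≡n (ℕ.≤-pred j<1+c)
  ... | inj₁ j<c = begin
    sumFrom (λ k → σ k * h k) 0 c + σ c * h c  ≡⟨ cong₂ _+_ (sumFrom-σ* h j<c) (trans (cong (_* h c) (σ-≢ (λ c≡j → ℕ.<-irrefl (sym c≡j) j<c))) (ℚ.*-identityˡ (h c))) ⟩
    sumFrom h 0 c - fromℕ 2 * h j + h c        ≡⟨ solve 3 (λ x y z → x :- y :+ z := x :+ z :- y) refl (sumFrom h 0 c) (fromℕ 2 * h j) (h c) ⟩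
    sumFrom h 0 c + h c - fromℕ 2 * h j        ∎
    where open ≡-Reasoning
  ... | inj₂ refl = begin
    sumFrom (λ k → σ k * h k) 0 j + σ j * h j  ≡⟨ cong₂ _+_ (σ-below j ℕ.≤-refl) (cong (_* h j) σ-j) ⟩
    sumFrom h 0 j + - 1ℚ * h j                 ≡⟨ solve 2 (λ x y → x :+ (:- con 1ℚ) :* y := x :+ y :- con (1ℚ + 1ℚ) :* y) refl (sumFrom h 0 j) (h j) ⟩
    sumFrom h 0 j + h j - fromℕ 2 * h j        ∎
    where
    open ≡-Reasoning
    σ-below : ∀ c → c ≤ j → sumFrom (λ k → σ k * h k) 0 c ≡ sumFrom h 0 c
    σ-below zero    _     = refl
    σ-below (suc c) 1+c≤j = cong₂ _+_ (σ-below c (ℕ.<⇒≤ 1+c≤j))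
      (trans (cong (_* h c) (σ-≢ (λ c≡j → ℕ.<-irrefl c≡j 1+c≤j))) (ℚ.*-identityˡ (h c)))

  signedSum : (ℕ → ℚ) → ℕ → ℚ
  signedSum g M = sum1 (λ m → sgn m * g m) M

  blockSum : (ℕ → ℚ) → ℕ → ℚ
  blockSum g n = sumFrom (λ k → σ k * g (B ℕ.* n ℕ.+ k)) 0 B

  gap : (ℕ → ℚ) → ℕ → ℚ
  gap g N = signedSum g (B ℕ.* N ℕ.+ b) - signedSum g N

  signedSum-++ : ∀ g N d → signedSum g (N ℕ.+ d) ≡ signedSum g N + sumFrom (λ m → sgn m * g m) (suc N) d
  signedSum-++ g N d = begin
    signedSum g (N ℕ.+ d)                                        ≡⟨ sum1≡sumFrom _ (N ℕ.+ d) ⟩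
    sumFrom (λ m → sgn m * g m) 1 (N ℕ.+ d)                      ≡⟨ sumFrom-++ _ 1 N d ⟩
    sumFrom (λ m → sgn m * g m) 1 N + sumFrom (λ m → sgn m * g m) (suc N) d ≡⟨ cong (_+ sumFrom (λ m → sgn m * g m) (suc N) d) (sum1≡sumFrom _ N) ⟨
    signedSum g N + sumFrom (λ m → sgn m * g m) (suc N) d        ∎
    where open ≡-Reasoning

  signedSum-digits : ∀ g → signedSum g b ≡ sumFrom g 1 b - fromℕ 2 * g j
  signedSum-digits g = begin
    signedSum g b                                       ≡⟨ sum1≡sumFrom _ b ⟩
    sumFrom (λ m → sgn m * g m) 1 b                     ≡⟨ sumFrom-cong 1 b (λ k k<b → cong (_* g (suc k)) (sgn-digit (s≤s k<b))) ⟩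
    sumFrom (λ k → σ k * g k) 1 b                       ≡⟨ solve 2 (λ x y → x := con 1ℚ :* y :+ x :- y) refl _ (g 0) ⟩
    1ℚ * g 0 + sumFrom (λ k → σ k * g k) 1 b - g 0      ≡⟨ cong (λ x → x * g 0 + sumFrom (λ k → σ k * g k) 1 b - g 0) (σ-≢ {0} (λ 0≡j → ℕ.<-irrefl 0≡j 1≤j)) ⟨
    σ 0 * g 0 + sumFrom (λ k → σ k * g k) 1 b - g 0     ≡⟨ cong (_- g 0) (sumFrom-head (λ k → σ k * g k) 0 b) ⟨
    sumFrom (λ k → σ k * g k) 0 B - g 0                 ≡⟨ cong (_- g 0) (sumFrom-σ* g j<B) ⟩
    sumFrom g 0 B - fromℕ 2 * g j - g 0                 ≡⟨ cong (λ x → x - fromℕ 2 * g j - g 0) (sumFrom-head g 0 b) ⟩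
    g 0 + sumFrom g 1 b - fromℕ 2 * g j - g 0           ≡⟨ solve 3 (λ x y z → x :+ y :- z :- x := y :- z) refl (g 0) (sumFrom g 1 b) (fromℕ 2 * g j) ⟩
    sumFrom g 1 b - fromℕ 2 * g j                       ∎
    where open ≡-Reasoning

  signedSum-blocks : ∀ g N → signedSum g (B ℕ.* N ℕ.+ b) ≡ signedSum g b + sum1 (λ n → sgn n * blockSum g n) N
  signedSum-blocks g zero    = trans (cong (signedSum g) (cong (ℕ._+ b) (ℕ.*-zeroʳ B))) (sym (ℚ.+-identityʳ _))
  signedSum-blocks g (suc N) = begin
    signedSum g (B ℕ.* suc N ℕ.+ b)                      ≡⟨ cong (signedSum g) (index b' N) ⟩
    signedSum g ((B ℕ.* N ℕ.+ b) ℕ.+ B)                  ≡⟨ signedSum-++ g (B ℕ.* N ℕ.+ b) B ⟩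
    signedSum g (B ℕ.* N ℕ.+ b) + sumFrom (λ m → sgn m * g m) (suc (B ℕ.* N ℕ.+ b)) B
      ≡⟨ cong₂ _+_ (signedSum-blocks g N) (trans (cong (λ a → sumFrom (λ m → sgn m * g m) a B) (start b' N)) (block (suc N))) ⟩
    signedSum g b + sum1 (λ n → sgn n * blockSum g n) N + sgn (suc N) * blockSum g (suc N)
      ≡⟨ ℚ.+-assoc (signedSum g b) _ _ ⟩
    signedSum g b + sum1 (λ n → sgn n * blockSum g n) (suc N) ∎
    where
    open ≡-Reasoning
    index : ∀ b' N → (2 ℕ.+ b') ℕ.* suc N ℕ.+ suc b' ≡ (2 ℕ.+ b') ℕ.* N ℕ.+ suc b' ℕ.+ (2 ℕ.+ b')
    index = solve-∀
    start : ∀ b' N → suc ((2 ℕ.+ b') ℕ.* N ℕ.+ suc b') ≡ (2 ℕ.+ b') ℕ.* suc N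
    start = solve-∀
    block : ∀ n → sumFrom (λ m → sgn m * g m) (B ℕ.* n) B ≡ sgn n * blockSum g n
    block n = begin
      sumFrom (λ m → sgn m * g m) (B ℕ.* n) B                       ≡⟨ sumFrom-shift _ (B ℕ.* n) B ⟩
      sumFrom (λ k → sgn (B ℕ.* n ℕ.+ k) * g (B ℕ.* n ℕ.+ k)) 0 B   ≡⟨ sumFrom-cong 0 B (λ k k<B → trans (cong (_* g (B ℕ.* n ℕ.+ k)) (sgn-step n k<B))
                                                                         (solve 3 (λ x y z → x :* y :* z := y :* (x :* z)) refl (σ k) (sgn n) (g (B ℕ.* n ℕ.+ k)))) ⟩
      sumFrom (λ k → sgn n * (σ k * g (B ℕ.* n ℕ.+ k))) 0 B         ≡⟨ sumFrom-*ˡ (sgn n) _ 0 B ⟩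
      sgn n * blockSum g n                                          ∎

  partialSum-blocks : ∀ g N → sum1 (λ n → sgn n * (g n - blockSum g n)) N ≡ signedSum g b - gap g N
  partialSum-blocks g N = begin
    sum1 (λ n → sgn n * (g n - blockSum g n)) N
      ≡⟨ sum1-cong N (λ n _ → solve 3 (λ s x y → s :* (x :- y) := s :* x :- s :* y) refl (sgn n) (g n) (blockSum g n)) ⟩
    sum1 (λ n → sgn n * g n - sgn n * blockSum g n) N
      ≡⟨ sum1-sub _ _ N ⟩
    signedSum g N - sum1 (λ n → sgn n * blockSum g n) N
      ≡⟨ solve 3 (λ x y z → x :- y := z :- ((z :+ y) :- x)) refl (signedSum g N) _ (signedSum g b) ⟩
    signedSum g b - (signedSum g b + sum1 (λ n → sgn n * blockSum g n) N - signedSum g N)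
      ≡⟨ cong (λ x → signedSum g b - (x - signedSum g N)) (signedSum-blocks g N) ⟨
    signedSum g b - gap g N
      ∎
    where open ≡-Reasoning

  gap≡difference : ∀ g N → gap g N ≡ signedSum g (N ℕ.+ b ℕ.* suc N) - signedSum g N
  gap≡difference g N = cong (λ M → signedSum g M - signedSum g N) (split b' N)
    where
    split : ∀ b' N → (2 ℕ.+ b') ℕ.* N ℕ.+ suc b' ≡ N ℕ.+ suc b' ℕ.* suc N
    split = solve-∀

  signedSum-difference : ∀ g N d → signedSum g (N ℕ.+ d) - signedSum g N ≡ sumFrom (λ m → sgn m * g m) (suc N) d
  signedSum-difference g N d = trans (cong (_- signedSum g N) (signedSum-++ g N d))
    (solve 2 (λ x y → x :+ y :- x := y) refl (signedSum g N) (sumFrom (λ m → sgn m * g m) (suc N) d))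

  ∣signedSum-difference∣≤ : ∀ g N d x → (∀ k → k < d → ∣ g (suc N ℕ.+ k) ∣ ℚ.≤ x) →
    ∣ signedSum g (N ℕ.+ d) - signedSum g N ∣ ℚ.≤ fromℕ d * x
  ∣signedSum-difference∣≤ g N d x ∣g∣≤x = subst (ℚ._≤ fromℕ d * x) (cong ∣_∣ (sym (signedSum-difference g N d)))
    (∣sumFrom∣≤length*bound _ x (suc N) d (λ k k<d → subst (ℚ._≤ x) (sym (∣sgn*p∣≡∣p∣ (suc N ℕ.+ k) _)) (∣g∣≤x k k<d)))

  ∣signedSum-difference∣≤inv : ∀ g N d → (∀ m → 1 ≤ m → ∣ g m ∣ ℚ.≤ inv m - inv (suc m)) →
    ∣ signedSum g (N ℕ.+ d) - signedSum g N ∣ ℚ.≤ inv (suc N)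
  ∣signedSum-difference∣≤inv g N d ∣g∣≤Δinv = begin
    ∣ signedSum g (N ℕ.+ d) - signedSum g N ∣           ≡⟨ cong ∣_∣ (signedSum-difference g N d) ⟩
    ∣ sumFrom (λ m → sgn m * g m) (suc N) d ∣           ≤⟨ ∣sumFrom∣≤telescope _ inv (suc N) d (λ k _ → subst (ℚ._≤ _) (sym (∣sgn*p∣≡∣p∣ (suc N ℕ.+ k) _)) (∣g∣≤Δinv (suc N ℕ.+ k) (s≤s z≤n))) ⟩
    inv (suc N) - inv (suc N ℕ.+ d)                     ≤⟨ p-q≤p (0≤inv (suc N ℕ.+ d)) ⟩
    inv (suc N)                                         ∎
    where open ℚ.≤-Reasoning

  invPronic : ℕ → ℚ
  invPronic m = inv (m ℕ.* (m ℕ.+ 1))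

  blockSum-invPronic : ∀ {n} → 1 ≤ n →
    blockSum invPronic n ≡ inv (B ℕ.* n) - inv (B ℕ.* suc n) - fromℕ 2 * invPronic (B ℕ.* n ℕ.+ j)
  blockSum-invPronic {n} 1≤n = begin
    blockSum invPronic n                                          ≡⟨ sumFrom-σ* (λ k → invPronic (B ℕ.* n ℕ.+ k)) j<B ⟩
    sumFrom (λ k → invPronic (B ℕ.* n ℕ.+ k)) 0 B - twice-j       ≡⟨ cong (_- twice-j) (sumFrom-shift invPronic (B ℕ.* n) B) ⟨
    sumFrom invPronic (B ℕ.* n) B - twice-j                       ≡⟨ cong (_- twice-j) (sumFrom-cong (B ℕ.* n) B (λ k _ → inv[m*[m+1]] {B ℕ.* n ℕ.+ k} (ℕ.≤-trans (1≤B*n 1≤n) (ℕ.m≤m+n _ k)))) ⟩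
    sumFrom (λ i → inv i - inv (suc i)) (B ℕ.* n) B - twice-j     ≡⟨ cong (_- twice-j) (sumFrom-telescope inv (B ℕ.* n) B) ⟩
    inv (B ℕ.* n) - inv (B ℕ.* n ℕ.+ B) - twice-j                 ≡⟨ cong (λ x → inv (B ℕ.* n) - inv x - twice-j) (trans (ℕ.+-comm (B ℕ.* n) B) (sym (ℕ.*-suc B n))) ⟩
    inv (B ℕ.* n) - inv (B ℕ.* suc n) - twice-j                   ∎
    where
    open ≡-Reasoning
    twice-j = fromℕ 2 * invPronic (B ℕ.* n ℕ.+ j)

  term₂ : ∀ {n} → 1 ≤ n →
    fromℕ b * invPronic n + fromℕ (2 ℕ.* B) * invPronic (B ℕ.* n ℕ.+ j) ≡ fromℕ B * (invPronic n - blockSum invPronic n)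
  term₂ {n} 1≤n = sym (begin
    fromℕ B * (invPronic n - blockSum invPronic n)
      ≡⟨ cong (λ x → fromℕ B * (invPronic n - x)) (blockSum-invPronic 1≤n) ⟩
    fromℕ B * (invPronic n - (X - X' - fromℕ 2 * Z))
      ≡⟨ solve 6 (λ P G X X' T Z → P :* (G :- (X :- X' :- T :* Z)) := P :* G :- (P :* X :- P :* X') :+ T :* P :* Z) refl (fromℕ B) (invPronic n) X X' (fromℕ 2) Z ⟩
    fromℕ B * invPronic n - (fromℕ B * X - fromℕ B * X') + fromℕ 2 * fromℕ B * Z
      ≡⟨ cong₂ (λ x y → fromℕ B * invPronic n - (x - y) + fromℕ 2 * fromℕ B * Z) (fromℕ*inv[m*n] 1≤B 1≤n) (fromℕ*inv[m*n] {n = suc n} 1≤B (s≤s z≤n)) ⟩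
    fromℕ B * invPronic n - (inv n - inv (suc n)) + fromℕ 2 * fromℕ B * Z
      ≡⟨ cong₂ (λ x y → fromℕ B * invPronic n - x + y * Z) (inv[m*[m+1]] 1≤n) (fromℕ-* 2 B) ⟨
    fromℕ B * invPronic n - invPronic n + fromℕ (2 ℕ.* B) * Z
      ≡⟨ cong (λ x → x * invPronic n - invPronic n + fromℕ (2 ℕ.* B) * Z) (fromℕ-suc b) ⟩
    (fromℕ b + 1ℚ) * invPronic n - invPronic n + fromℕ (2 ℕ.* B) * Z
      ≡⟨ solve 3 (λ Q G W → (Q :+ con 1ℚ) :* G :- G :+ W := Q :* G :+ W) refl (fromℕ b) (invPronic n) (fromℕ (2 ℕ.* B) * Z) ⟩
    fromℕ b * invPronic n + fromℕ (2 ℕ.* B) * Z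
      ∎)
    where
    open ≡-Reasoning
    X  = inv (B ℕ.* n)
    X' = inv (B ℕ.* suc n)
    Z  = invPronic (B ℕ.* n ℕ.+ j)

  fromℕ-B*signedSum-invPronic : fromℕ B * signedSum invPronic b ≡ fromℕ b - fromℕ (2 ℕ.* B) * invPronic j
  fromℕ-B*signedSum-invPronic = begin
    fromℕ B * signedSum invPronic b                            ≡⟨ cong (fromℕ B *_) (signedSum-digits invPronic) ⟩
    fromℕ B * (sumFrom invPronic 1 b - fromℕ 2 * invPronic j)  ≡⟨ cong (λ x → fromℕ B * (x - fromℕ 2 * invPronic j)) telescope ⟩
    fromℕ B * (1ℚ - inv B - fromℕ 2 * invPronic j)             ≡⟨ solve 4 (λ P I T G → P :* (con 1ℚ :- I :- T :* G) := P :- I :* P :- T :* P :* G) refl (fromℕ B) (inv B) (fromℕ 2) (invPronic j) ⟩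
    fromℕ B - inv B * fromℕ B - fromℕ 2 * fromℕ B * invPronic j ≡⟨ cong₂ (λ x y → fromℕ B - x - y * invPronic j) (inv*fromℕ≡1 1≤B) (sym (fromℕ-* 2 B)) ⟩
    fromℕ B - 1ℚ - fromℕ (2 ℕ.* B) * invPronic j               ≡⟨ cong (λ x → x - 1ℚ - fromℕ (2 ℕ.* B) * invPronic j) (fromℕ-suc b) ⟩
    fromℕ b + 1ℚ - 1ℚ - fromℕ (2 ℕ.* B) * invPronic j          ≡⟨ solve 2 (λ x y → x :+ con 1ℚ :- con 1ℚ :- y := x :- y) refl (fromℕ b) (fromℕ (2 ℕ.* B) * invPronic j) ⟩
    fromℕ b - fromℕ (2 ℕ.* B) * invPronic j                    ∎
    where
    open ≡-Reasoning
    telescope : sumFrom invPronic 1 b ≡ 1ℚ - inv B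
    telescope = trans (sumFrom-cong 1 b (λ k _ → inv[m*[m+1]] {suc k} (s≤s z≤n))) (sumFrom-telescope inv 1 b)

  ∣gap-invPronic∣≤ : ∀ N → ∣ gap invPronic N ∣ ℚ.≤ inv (suc N)
  ∣gap-invPronic∣≤ N = subst (ℚ._≤ inv (suc N)) (cong ∣_∣ (sym (gap≡difference invPronic N)))
    (∣signedSum-difference∣≤inv invPronic N (b ℕ.* suc N) (λ m 1≤m → ℚ.≤-reflexive
      (trans (ℚ.0≤p⇒∣p∣≡p (0≤inv (m ℕ.* (m ℕ.+ 1)))) (inv[m*[m+1]] 1≤m))))

  series₂ : SeriesSumsTo (λ n → sgn n * (fromℕ b * invPronic n + fromℕ (2 ℕ.* B) * invPronic (B ℕ.* n ℕ.+ j)))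
                         (fromℕ b - fromℕ (2 ℕ.* B) * invPronic j)
  series₂ = tendsToZero-≤fromℕ*inv B λ M → begin
    ∣ sum1 (λ n → sgn n * (fromℕ b * invPronic n + fromℕ (2 ℕ.* B) * invPronic (B ℕ.* n ℕ.+ j))) M - (fromℕ b - fromℕ (2 ℕ.* B) * invPronic j) ∣
      ≡⟨ cong₂ (λ x y → ∣ x - y ∣) (partialSum M) fromℕ-B*signedSum-invPronic ⟨
    ∣ fromℕ B * (signedSum invPronic b - gap invPronic M) - fromℕ B * signedSum invPronic b ∣
      ≡⟨ cong ∣_∣ (solve 3 (λ P S g → P :* (S :- g) :- P :* S := :- (P :* g)) refl (fromℕ B) (signedSum invPronic b) (gap invPronic M)) ⟩
    ∣ - (fromℕ B * gap invPronic M) ∣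
      ≡⟨ trans (ℚ.∣-p∣≡∣p∣ _) (ℚ.∣p*q∣≡∣p∣*∣q∣ (fromℕ B) (gap invPronic M)) ⟩
    ∣ fromℕ B ∣ * ∣ gap invPronic M ∣
      ≡⟨ cong (_* ∣ gap invPronic M ∣) (ℚ.0≤p⇒∣p∣≡p (0≤fromℕ B)) ⟩
    fromℕ B * ∣ gap invPronic M ∣
      ≤⟨ ℚ.*-monoˡ-≤-nonNeg (fromℕ B) {{ℚ.nonNegative (0≤fromℕ B)}} (∣gap-invPronic∣≤ M) ⟩
    fromℕ B * inv (suc M)
      ∎
    where
    open ℚ.≤-Reasoning
    partialSum : ∀ M → fromℕ B * (signedSum invPronic b - gap invPronic M)
                     ≡ sum1 (λ n → sgn n * (fromℕ b * invPronic n + fromℕ (2 ℕ.* B) * invPronic (B ℕ.* n ℕ.+ j))) M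
    partialSum M = sym (begin-equality
      sum1 (λ n → sgn n * (fromℕ b * invPronic n + fromℕ (2 ℕ.* B) * invPronic (B ℕ.* n ℕ.+ j))) M
        ≡⟨ sum1-cong M (λ n 1≤n → trans (cong (sgn n *_) (term₂ 1≤n)) (solve 3 (λ s P x → s :* (P :* x) := P :* (s :* x)) refl (sgn n) (fromℕ B) _)) ⟩
      sum1 (λ n → fromℕ B * (sgn n * (invPronic n - blockSum invPronic n))) M
        ≡⟨ sum1-*ˡ (fromℕ B) _ M ⟩
      fromℕ B * sum1 (λ n → sgn n * (invPronic n - blockSum invPronic n)) M
        ≡⟨ cong (fromℕ B *_) (partialSum-blocks invPronic M) ⟩
      fromℕ B * (signedSum invPronic b - gap invPronic M)
        ∎)

  term₁ : ∀ {n} → 1 ≤ n →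
    fromℕ 2 * inv (B ℕ.* n ℕ.+ j) + inv (B ℕ.* n) * sum1 (λ k → fromℕ k * inv (B ℕ.* n ℕ.+ k)) b ≡ inv n - blockSum inv n
  term₁ {n} 1≤n = begin
    fromℕ 2 * Z + inv x * sum1 (λ k → fromℕ k * inv (x ℕ.+ k)) b
      ≡⟨ cong (_+_ (fromℕ 2 * Z)) inv*Σ ⟩
    fromℕ 2 * Z + (fromℕ b * inv x - Y)
      ≡⟨ solve 5 (λ T Z Q X Y → T :* Z :+ (Q :* X :- Y) := (Q :+ con 1ℚ) :* X :- ((X :+ Y) :- T :* Z)) refl (fromℕ 2) Z (fromℕ b) (inv x) Y ⟩
    (fromℕ b + 1ℚ) * inv x - ((inv x + Y) - fromℕ 2 * Z)
      ≡⟨ cong₂ (λ u v → u * inv x - v) (fromℕ-suc b) blockSum-inv ⟨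
    fromℕ B * inv x - blockSum inv n
      ≡⟨ cong (_- blockSum inv n) (fromℕ*inv[m*n] 1≤B 1≤n) ⟩
    inv n - blockSum inv n
      ∎
    where
    open ≡-Reasoning
    x = B ℕ.* n
    Z = inv (x ℕ.+ j)
    Y = sumFrom (λ k → inv (x ℕ.+ k)) 1 b
    inv*Σ : inv x * sum1 (λ k → fromℕ k * inv (x ℕ.+ k)) b ≡ fromℕ b * inv x - Y
    inv*Σ = begin
      inv x * sum1 (λ k → fromℕ k * inv (x ℕ.+ k)) b        ≡⟨ sum1-*ˡ (inv x) _ b ⟨
      sum1 (λ k → inv x * (fromℕ k * inv (x ℕ.+ k))) b      ≡⟨ sum1-cong b (λ k _ → inv*fromℕ*inv[m+k] k (1≤B*n 1≤n)) ⟩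
      sum1 (λ k → inv x - inv (x ℕ.+ k)) b                  ≡⟨ sum1≡sumFrom _ b ⟩
      sumFrom (λ k → inv x - inv (x ℕ.+ k)) 1 b             ≡⟨ sumFrom-sub (λ _ → inv x) (λ k → inv (x ℕ.+ k)) 1 b ⟩
      sumFrom (λ _ → inv x) 1 b - Y                         ≡⟨ cong (_- Y) (sumFrom-const (inv x) 1 b) ⟩
      fromℕ b * inv x - Y                                   ∎
    blockSum-inv : blockSum inv n ≡ inv x + Y - fromℕ 2 * Z
    blockSum-inv = begin
      blockSum inv n                                      ≡⟨ sumFrom-σ* (λ k → inv (x ℕ.+ k)) j<B ⟩
      sumFrom (λ k → inv (x ℕ.+ k)) 0 B - fromℕ 2 * Z     ≡⟨ cong (_- fromℕ 2 * Z) (sumFrom-head (λ k → inv (x ℕ.+ k)) 0 b) ⟩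
      inv (x ℕ.+ 0) + Y - fromℕ 2 * Z                     ≡⟨ cong (λ i → inv i + Y - fromℕ 2 * Z) (ℕ.+-identityʳ x) ⟩
      inv x + Y - fromℕ 2 * Z                             ∎

  signedSum-inv-digits : H b - fromℕ 2 * inv j ≡ signedSum inv b
  signedSum-inv-digits = trans (cong (_- fromℕ 2 * inv j) (sum1≡sumFrom inv b)) (sym (signedSum-digits inv))

  ∣gap-inv∣≤ : ∀ N → ∣ gap inv N ∣ ℚ.≤ fromℕ b
  ∣gap-inv∣≤ N = begin
    ∣ gap inv N ∣                                  ≡⟨ cong ∣_∣ (gap≡difference inv N) ⟩
    ∣ signedSum inv (N ℕ.+ b ℕ.* suc N) - signedSum inv N ∣
      ≤⟨ ∣signedSum-difference∣≤ inv N (b ℕ.* suc N) (inv (suc N)) (λ k _ →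
           ℚ.≤-trans (ℚ.≤-reflexive (ℚ.0≤p⇒∣p∣≡p (0≤inv (suc N ℕ.+ k)))) (inv-antimono-≤ (s≤s z≤n) (ℕ.m≤m+n (suc N) k))) ⟩
    fromℕ (b ℕ.* suc N) * inv (suc N)              ≡⟨ cong (_* inv (suc N)) (fromℕ-* b (suc N)) ⟩
    fromℕ b * fromℕ (suc N) * inv (suc N)          ≡⟨ solve 3 (λ x y z → x :* y :* z := x :* (z :* y)) refl (fromℕ b) (fromℕ (suc N)) (inv (suc N)) ⟩
    fromℕ b * (inv (suc N) * fromℕ (suc N))        ≡⟨ cong (fromℕ b *_) (inv*fromℕ≡1 {suc N} (s≤s z≤n)) ⟩
    fromℕ b * 1ℚ                                   ≡⟨ ℚ.*-identityʳ (fromℕ b) ⟩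
    fromℕ b                                        ∎
    where open ℚ.≤-Reasoning

  private
    ρ : ℚ
    ρ = fromℕ b' * inv B

    fromℕ-B≡b'+2 : fromℕ B ≡ fromℕ b' + fromℕ 2
    fromℕ-B≡b'+2 = trans (fromℕ-+ 2 b') (ℚ.+-comm (fromℕ 2) (fromℕ b'))

  -- The sum over a block is ρ / n up to an error η n of order 1 / n².
  η : ℕ → ℚ
  η n = blockSum inv n - ρ * inv n

  sumFrom-σ*const : ∀ x → sumFrom (λ k → σ k * x) 0 B ≡ fromℕ b' * x
  sumFrom-σ*const x = begin
    sumFrom (λ k → σ k * x) 0 B                  ≡⟨ sumFrom-σ* (λ _ → x) j<B ⟩
    sumFrom (λ _ → x) 0 B - fromℕ 2 * x          ≡⟨ cong (_- fromℕ 2 * x) (sumFrom-const x 0 B) ⟩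
    fromℕ B * x - fromℕ 2 * x                    ≡⟨ cong (λ z → z * x - fromℕ 2 * x) fromℕ-B≡b'+2 ⟩
    (fromℕ b' + fromℕ 2) * x - fromℕ 2 * x       ≡⟨ solve 3 (λ a c x → (a :+ c) :* x :- c :* x := a :* x) refl (fromℕ b') (fromℕ 2) x ⟩
    fromℕ b' * x                                 ∎
    where open ≡-Reasoning

  η≡sumFrom : ∀ {n} → 1 ≤ n → η n ≡ sumFrom (λ k → σ k * (inv (B ℕ.* n ℕ.+ k) - inv (B ℕ.* n))) 0 B
  η≡sumFrom {n} 1≤n = begin
    blockSum inv n - ρ * inv n                                    ≡⟨ cong (_-_ (blockSum inv n)) ρ*inv≡ ⟩
    blockSum inv n - sumFrom (λ k → σ k * inv x) 0 B              ≡⟨ sumFrom-sub (λ k → σ k * inv (x ℕ.+ k)) (λ k → σ k * inv x) 0 B ⟨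
    sumFrom (λ k → σ k * inv (x ℕ.+ k) - σ k * inv x) 0 B         ≡⟨ sumFrom-cong 0 B (λ k _ → solve 3 (λ s u v → s :* u :- s :* v := s :* (u :- v)) refl (σ k) _ _) ⟩
    sumFrom (λ k → σ k * (inv (x ℕ.+ k) - inv x)) 0 B             ∎
    where
    open ≡-Reasoning
    x = B ℕ.* n
    ρ*inv≡ : ρ * inv n ≡ sumFrom (λ k → σ k * inv x) 0 B
    ρ*inv≡ = trans (ℚ.*-assoc (fromℕ b') (inv B) (inv n))
      (trans (cong (fromℕ b' *_) (sym (inv-* 1≤B 1≤n))) (sym (sumFrom-σ*const (inv x))))

  ∣η∣≤ : ∀ n → 1 ≤ n → ∣ η n ∣ ℚ.≤ inv n - inv (suc n)
  ∣η∣≤ n 1≤n = begin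
    ∣ η n ∣
      ≡⟨ cong ∣_∣ (η≡sumFrom 1≤n) ⟩
    ∣ sumFrom (λ k → σ k * (inv (x ℕ.+ k) - inv x)) 0 B ∣
      ≤⟨ ∣sumFrom∣≤length*bound _ _ 0 B each ⟩
    fromℕ B * (inv x - inv (x ℕ.+ B))
      ≡⟨ solve 3 (λ P a c → P :* (a :- c) := P :* a :- P :* c) refl (fromℕ B) (inv x) (inv (x ℕ.+ B)) ⟩
    fromℕ B * inv x - fromℕ B * inv (x ℕ.+ B)
      ≡⟨ cong₂ (λ u v → u - fromℕ B * inv v) (fromℕ*inv[m*n] 1≤B 1≤n) (trans (ℕ.+-comm x B) (sym (ℕ.*-suc B n))) ⟩
    inv n - fromℕ B * inv (B ℕ.* suc n)
      ≡⟨ cong (_-_ (inv n)) (fromℕ*inv[m*n] {n = suc n} 1≤B (s≤s z≤n)) ⟩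
    inv n - inv (suc n)
      ∎
    where
    open ℚ.≤-Reasoning
    x = B ℕ.* n
    1≤x = 1≤B*n 1≤n
    each : ∀ k → k < B → ∣ σ k * (inv (x ℕ.+ k) - inv x) ∣ ℚ.≤ inv x - inv (x ℕ.+ B)
    each k k<B = begin
      ∣ σ k * (inv (x ℕ.+ k) - inv x) ∣   ≡⟨ ∣signPow*p∣≡∣p∣ (δ j k) _ ⟩
      ∣ inv (x ℕ.+ k) - inv x ∣           ≡⟨ ∣p-q∣≡q-p (inv-antimono-≤ 1≤x (ℕ.m≤m+n x k)) ⟩
      inv x - inv (x ℕ.+ k)               ≤⟨ ℚ.+-monoʳ-≤ (inv x) (ℚ.neg-antimono-≤ (inv-antimono-≤ (ℕ.≤-trans 1≤x (ℕ.m≤m+n x k)) (ℕ.+-monoʳ-≤ x (ℕ.<⇒≤ k<B)))) ⟩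
      inv x - inv (x ℕ.+ B)               ∎

  signedSum-inv-blocks : ∀ N → signedSum inv (B ℕ.* N ℕ.+ b) ≡ signedSum inv b + ρ * signedSum inv N + signedSum η N
  signedSum-inv-blocks N = begin
    signedSum inv (B ℕ.* N ℕ.+ b)                                          ≡⟨ signedSum-blocks inv N ⟩
    signedSum inv b + sum1 (λ n → sgn n * blockSum inv n) N                 ≡⟨ cong (_+_ (signedSum inv b)) (sum1-cong N (λ n _ →
                                                                               solve 4 (λ s d r i → s :* d := r :* (s :* i) :+ s :* (d :- r :* i)) refl (sgn n) (blockSum inv n) ρ (inv n))) ⟩
    signedSum inv b + sum1 (λ n → ρ * (sgn n * inv n) + sgn n * η n) N      ≡⟨ cong (_+_ (signedSum inv b)) (sum1-+ _ _ N) ⟩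
    signedSum inv b + (sum1 (λ n → ρ * (sgn n * inv n)) N + signedSum η N)  ≡⟨ cong (λ x → signedSum inv b + (x + signedSum η N)) (sum1-*ˡ ρ _ N) ⟩
    signedSum inv b + (ρ * signedSum inv N + signedSum η N)                 ≡⟨ ℚ.+-assoc (signedSum inv b) _ _ ⟨
    signedSum inv b + ρ * signedSum inv N + signedSum η N                   ∎
    where open ≡-Reasoning

  private
    0≤ρ : 0ℚ ℚ.≤ ρ
    0≤ρ = 0≤fromℕ*inv b' B

    1-ρ≡2/B : 1ℚ - ρ ≡ fromℕ 2 * inv B
    1-ρ≡2/B = begin
      1ℚ - fromℕ b' * inv B                               ≡⟨ cong (_- fromℕ b' * inv B) (trans (sym (inv*fromℕ≡1 1≤B)) (cong (inv B *_) fromℕ-B≡b'+2)) ⟩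
      inv B * (fromℕ b' + fromℕ 2) - fromℕ b' * inv B     ≡⟨ solve 3 (λ i a c → i :* (a :+ c) :- a :* i := c :* i) refl (inv B) (fromℕ b') (fromℕ 2) ⟩
      fromℕ 2 * inv B                                     ∎
      where open ≡-Reasoning

    ∣[1-ρ]*p∣≤∣p∣ : ∀ p → ∣ (1ℚ - ρ) * p ∣ ℚ.≤ ∣ p ∣
    ∣[1-ρ]*p∣≤∣p∣ p = begin
      ∣ (1ℚ - ρ) * p ∣              ≡⟨ ℚ.∣p*q∣≡∣p∣*∣q∣ (1ℚ - ρ) p ⟩
      ∣ 1ℚ - ρ ∣ * ∣ p ∣            ≡⟨ cong (λ x → ∣ x ∣ * ∣ p ∣) 1-ρ≡2/B ⟩
      ∣ fromℕ 2 * inv B ∣ * ∣ p ∣   ≡⟨ cong (_* ∣ p ∣) (ℚ.0≤p⇒∣p∣≡p (0≤fromℕ*inv 2 B)) ⟩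
      fromℕ 2 * inv B * ∣ p ∣       ≤⟨ ℚ.*-monoʳ-≤-nonNeg ∣ p ∣ {{ℚ.nonNegative (ℚ.0≤∣p∣ p)}} (fraction-mono-≤ 2 B 1 1 1≤B (s≤s z≤n) (ℕ.*-monoʳ-≤ 1 2≤B)) ⟩
      fromℕ 1 * inv 1 * ∣ p ∣       ≡⟨ ℚ.*-identityˡ ∣ p ∣ ⟩
      ∣ p ∣                         ∎
      where open ℚ.≤-Reasoning

  -- Pure algebra from signedSum-inv-blocks at M and at N; the last two terms are O(1/N).
  gap-inv-step : ∀ N r → let M = B ℕ.* N ℕ.+ r in
    gap inv M ≡ ρ * gap inv N + (signedSum η M - signedSum η N) + (1ℚ - ρ) * (signedSum inv (B ℕ.* N ℕ.+ b) - signedSum inv M)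
  gap-inv-step N r = begin
    S (B ℕ.* M ℕ.+ b) - S M
      ≡⟨ cong (_- S M) (signedSum-inv-blocks M) ⟩
    S b + ρ * S M + A M - S M
      ≡⟨ solve 6 (λ Sb ρ SN AN SM AM → Sb :+ ρ :* SM :+ AM :- SM :=
                   ρ :* ((Sb :+ ρ :* SN :+ AN) :- SN) :+ (AM :- AN) :+ (con 1ℚ :- ρ) :* ((Sb :+ ρ :* SN :+ AN) :- SM))
           refl (S b) ρ (S N) (A N) (S M) (A M) ⟩
    ρ * ((S b + ρ * S N + A N) - S N) + (A M - A N) + (1ℚ - ρ) * ((S b + ρ * S N + A N) - S M)
      ≡⟨ cong (λ X → ρ * (X - S N) + (A M - A N) + (1ℚ - ρ) * (X - S M)) (signedSum-inv-blocks N) ⟨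
    ρ * gap inv N + (A M - A N) + (1ℚ - ρ) * (S (B ℕ.* N ℕ.+ b) - S M)
      ∎
    where
    open ≡-Reasoning
    M = B ℕ.* N ℕ.+ r
    S = signedSum inv
    A = signedSum η

  gap-inv-recurrence : ∀ N r → 1 ≤ N → r < B → ∣ gap inv (B ℕ.* N ℕ.+ r) ∣ ℚ.≤ ρ * ∣ gap inv N ∣ + (inv N + inv N)
  gap-inv-recurrence N r 1≤N r<B = begin
    ∣ gap inv M ∣
      ≡⟨ cong ∣_∣ (gap-inv-step N r) ⟩
    ∣ ρ * gap inv N + Δ + (1ℚ - ρ) * δ′ ∣
      ≤⟨ ℚ.≤-trans (ℚ.∣p+q∣≤∣p∣+∣q∣ (ρ * gap inv N + Δ) ((1ℚ - ρ) * δ′)) (ℚ.+-monoˡ-≤ ∣ (1ℚ - ρ) * δ′ ∣ (ℚ.∣p+q∣≤∣p∣+∣q∣ (ρ * gap inv N) Δ)) ⟩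
    ∣ ρ * gap inv N ∣ + ∣ Δ ∣ + ∣ (1ℚ - ρ) * δ′ ∣
      ≤⟨ ℚ.+-mono-≤ (ℚ.+-monoʳ-≤ ∣ ρ * gap inv N ∣ ∣Δ∣≤) (ℚ.≤-trans (∣[1-ρ]*p∣≤∣p∣ δ′) ∣δ′∣≤) ⟩
    ∣ ρ * gap inv N ∣ + inv N + inv N
      ≡⟨ cong (λ x → x + inv N + inv N) (trans (ℚ.∣p*q∣≡∣p∣*∣q∣ ρ (gap inv N)) (cong (_* ∣ gap inv N ∣) (ℚ.0≤p⇒∣p∣≡p 0≤ρ))) ⟩
    ρ * ∣ gap inv N ∣ + inv N + inv N
      ≡⟨ ℚ.+-assoc (ρ * ∣ gap inv N ∣) (inv N) (inv N) ⟩
    ρ * ∣ gap inv N ∣ + (inv N + inv N)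
      ∎
    where
    open ℚ.≤-Reasoning
    M = B ℕ.* N ℕ.+ r
    S = signedSum inv
    A = signedSum η
    Δ = A M - A N
    δ′ = S (B ℕ.* N ℕ.+ b) - S M

    ∣Δ∣≤ : ∣ Δ ∣ ℚ.≤ inv N
    ∣Δ∣≤ = begin
      ∣ A M - A N ∣                                     ≡⟨ cong (λ x → ∣ A x - A N ∣) (split b' N r) ⟩
      ∣ A (N ℕ.+ (b ℕ.* N ℕ.+ r)) - A N ∣               ≤⟨ ∣signedSum-difference∣≤inv η N (b ℕ.* N ℕ.+ r) ∣η∣≤ ⟩
      inv (suc N)                                       ≤⟨ inv-antimono-≤ 1≤N (ℕ.n≤1+n N) ⟩
      inv N                                             ∎
      where
      split : ∀ b' N r → (2 ℕ.+ b') ℕ.* N ℕ.+ r ≡ N ℕ.+ (suc b' ℕ.* N ℕ.+ r)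
      split = solve-∀

    ∣δ′∣≤ : ∣ δ′ ∣ ℚ.≤ inv N
    ∣δ′∣≤ = begin
      ∣ S (B ℕ.* N ℕ.+ b) - S M ∣
        ≡⟨ cong (λ x → ∣ S x - S M ∣) BN+b≡M+[b-r] ⟩
      ∣ S (M ℕ.+ (b ℕ.∸ r)) - S M ∣
        ≤⟨ ∣signedSum-difference∣≤ inv M (b ℕ.∸ r) (inv (B ℕ.* N)) (λ k _ →
             ℚ.≤-trans (ℚ.≤-reflexive (ℚ.0≤p⇒∣p∣≡p (0≤inv (suc M ℕ.+ k))))
               (inv-antimono-≤ (1≤B*n 1≤N) (ℕ.≤-trans (ℕ.m≤m+n (B ℕ.* N) r) (ℕ.≤-trans (ℕ.n≤1+n M) (ℕ.m≤m+n (suc M) k))))) ⟩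
      fromℕ (b ℕ.∸ r) * inv (B ℕ.* N)
        ≤⟨ ℚ.*-monoʳ-≤-nonNeg (inv (B ℕ.* N)) {{ℚ.nonNegative (0≤inv (B ℕ.* N))}} (fromℕ-mono-≤ (ℕ.≤-trans (ℕ.m∸n≤m b r) (ℕ.n≤1+n b))) ⟩
      fromℕ B * inv (B ℕ.* N)
        ≡⟨ fromℕ*inv[m*n] 1≤B 1≤N ⟩
      inv N
        ∎
      where
      BN+b≡M+[b-r] : B ℕ.* N ℕ.+ b ≡ M ℕ.+ (b ℕ.∸ r)
      BN+b≡M+[b-r] = trans (cong (B ℕ.* N ℕ.+_) (sym (ℕ.m+[n∸m]≡n (ℕ.≤-pred r<B)))) (sym (ℕ.+-assoc (B ℕ.* N) r (b ℕ.∸ r)))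

  series₁ : SeriesSumsTo (λ n → sgn n * (fromℕ 2 * inv (B ℕ.* n ℕ.+ j) + inv (B ℕ.* n) * sum1 (λ k → fromℕ k * inv (B ℕ.* n ℕ.+ k)) b))
                         (H b - fromℕ 2 * inv j)
  series₁ = tendsToZero-≤ (λ M → ℚ.≤-reflexive (begin
      ∣ sum1 (λ n → sgn n * (fromℕ 2 * inv (B ℕ.* n ℕ.+ j) + inv (B ℕ.* n) * sum1 (λ k → fromℕ k * inv (B ℕ.* n ℕ.+ k)) b)) M - (H b - fromℕ 2 * inv j) ∣
        ≡⟨ cong₂ (λ x y → ∣ x - y ∣) (trans (sum1-cong M (λ n 1≤n → cong (sgn n *_) (term₁ 1≤n))) (partialSum-blocks inv M)) signedSum-inv-digits ⟩
      ∣ signedSum inv b - gap inv M - signedSum inv b ∣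
        ≡⟨ cong ∣_∣ (solve 2 (λ S g → S :- g :- S := :- g) refl (signedSum inv b) (gap inv M)) ⟩
      ∣ - gap inv M ∣
        ≡⟨ ℚ.∣-p∣≡∣p∣ (gap inv M) ⟩
      ∣ gap inv M ∣
        ∎))
    (Contraction.tendsToZero b' (gap inv) b ∣gap-inv∣≤ gap-inv-recurrence)
    where open ≡-Reasoning

corollary6 : (B : ℕ) (2≤B : 2 ≤ B) (j : ℕ) → 1 ≤ j → j < B →
    SeriesSumsTo
      (λ n → signPow (digitCount B 2≤B j n) *
        ((+ 2 ÷ 1) * inv (B Data.Nat.* n Data.Nat.+ j)
          + inv (B Data.Nat.* n) * sum1 (λ k → (+ k ÷ 1) * inv (B Data.Nat.* n Data.Nat.+ k)) (B Data.Nat.∸ 1)))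
      (H (B Data.Nat.∸ 1) - (+ 2 ÷ 1) * inv j)
    ×
    SeriesSumsTo
      (λ n → signPow (digitCount B 2≤B j n) *
        ((+ (B Data.Nat.∸ 1) ÷ 1) * inv (n Data.Nat.* (n Data.Nat.+ 1))
          + (+ (2 Data.Nat.* B) ÷ 1) * inv ((B Data.Nat.* n Data.Nat.+ j) Data.Nat.* (B Data.Nat.* n Data.Nat.+ j Data.Nat.+ 1))))
      ((+ (B Data.Nat.∸ 1) ÷ 1) - (+ (2 Data.Nat.* B) ÷ 1) * inv (j Data.Nat.* (j Data.Nat.+ 1)))
corollary6 (suc (suc b')) (s≤s (s≤s z≤n)) j 1≤j j<B = DigitSeries.series₁ b' 1≤j j<B , DigitSeries.series₂ b' 1≤j j<B
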